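{- Let $\widehat{H}$ be a finite weakly balanced bipartite signed graph with no purely red edges, and let $\le$ be a special min ordering of $\widehat H$. Let $\widehat G$ be a signed graph, let $C$ be a closed walk in $\widehat{G}$, and let $f, f'$ be two homomorphisms of $\widehat{G}$ to $\widehat{H}$ such that for every vertex $v$ of $\widehat{G}$, $f(v)$ and $f'(v)$ lie in the same part of $H$ and $f(v) \leq f'(v)$, and such that the image $f(C)$ contains only blue edges while the image $f'(C)$ contains a bicoloured edge. Then the homomorphic images $f(C)$ and $f'(C)$ are disjoint (have no common vertex).
   Context: A signed graph is a graph whose edges each carry the sign $+$ (blue), $-$ (red), or both (bicoloured); an edge with exactly one sign is unicoloured. $\widehat H$ is weakly balanced with no purely red edges, so its unicoloured edges are blue; it is bipartite with underlying graph $H$ having parts $A,B$. A homomorphism of a signed graph $\widehat G$ to $\widehat H$ is a homomorphism $f$ of the underlying graphs mapping bicoloured edges to bicoloured edges such that every closed walk $W$ of unicoloured edges of $\widehat G$ whose image $f(W)$ consists of unicoloured edges has the same parity of the number of red edges as $f(W)$. A min ordering of $H$ is a pair of linear orders of $A$ and of $B$ such that whenever $ab, a'b'$ are edges with $a,a'\in A$, $a<a'$, $b,b'\in B$, $b'<b$, then $ab'$ is an edge. A special min ordering of $\widehat H$ is a min ordering of $H$ such that at each vertex, every neighbour joined to it by a bicoloured edge precedes every neighbour joined to it by a unicoloured edge. -}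

module Defs where

open import Data.Nat using (ℕ; zero; suc; _+_; _%_)
open import Data.Fin using (Fin)
open import Data.Bool using (Bool; true; false)
open import Data.Unit using (⊤)
open import Data.Empty using (⊥)
open import Data.List using (List; []; _∷_; map)
open import Data.List.Relation.Unary.All using (All)
open import Data.List.Relation.Unary.Any using (Any)
open import Data.List.Membership.Propositional using (_∈_)
open import Data.Product using (_×_; _,_; Σ; ∃; proj₁; proj₂)
open import Relation.Binary.PropositionalEquality using (_≡_; _≢_)
open import Relation.Nullary using (¬_)

-- Colour of the pair {u,v}: no edge, blue (+ only), red (- only), bicoloured (both signs).
data Col : Set where
  none blue red bi : Col

IsEdge : Col → Set
IsEdge c = c ≢ none

Unicoloured : Col → Set
Unicoloured blue = ⊤
Unicoloured red  = ⊤
Unicoloured _    = ⊥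

record SignedGraph (n : ℕ) : Set where
  field
    col : Fin n → Fin n → Col
    col-sym : ∀ u v → col u v ≡ col v u
open SignedGraph public

steps : {A : Set} → A → List A → List (A × A)
steps v []       = []
steps v (w ∷ ws) = (v , w) ∷ steps w ws

lastV : {A : Set} → A → List A → A
lastV v []       = v
lastV v (w ∷ ws) = lastV w ws

module _ {n : ℕ} (G : SignedGraph n) where

  IsWalk : Fin n → List (Fin n) → Set
  IsWalk v vs = All (λ p → IsEdge (col G (proj₁ p) (proj₂ p))) (steps v vs)

  IsClosedWalk : Fin n → List (Fin n) → Set
  IsClosedWalk v vs = IsWalk v vs × (lastV v vs ≡ v)

  AllUnicoloured : Fin n → List (Fin n) → Set
  AllUnicoloured v vs = All (λ p → Unicoloured (col G (proj₁ p) (proj₂ p))) (steps v vs)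

  isRed : Col → ℕ
  isRed red = 1
  isRed _   = 0

  redCount : List (Fin n × Fin n) → ℕ
  redCount []             = 0
  redCount ((x , y) ∷ ps) = isRed (col G x y) + redCount ps

  WeaklyBalanced : Set
  WeaklyBalanced = ∀ v vs → IsClosedWalk v vs → AllUnicoloured v vs →
                   redCount (steps v vs) % 2 ≡ 0

  NoPurelyRed : Set
  NoPurelyRed = ∀ u v → col G u v ≢ red

  -- bipartite with the given parts (part u = true : u ∈ A, false : u ∈ B)
  BipartiteWith : (Fin n → Bool) → Set
  BipartiteWith part = ∀ u v → IsEdge (col G u v) → part u ≢ part v

  -- min ordering, given as one linear order on all vertices, of which only
  -- the restrictions to A and to B matter
  IsMinOrdering : (Fin n → Bool) → (Fin n → Fin n → Set) → Set
  IsMinOrdering part _<_ =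
    ∀ a b a' b' → part a ≡ true → part a' ≡ true →
      part b ≡ false → part b' ≡ false →
      IsEdge (col G a b) → IsEdge (col G a' b') → a < a' → b' < b →
      IsEdge (col G a b')

  IsSpecial : (Fin n → Fin n → Set) → Set
  IsSpecial _<_ = ∀ v u w → col G v u ≡ bi → Unicoloured (col G v w) → u < w

module _ {m n : ℕ} (G : SignedGraph m) (H : SignedGraph n) where

  IsHom : (Fin m → Fin n) → Set
  IsHom f =
      (∀ u v → IsEdge (col G u v) → IsEdge (col H (f u) (f v)))
    × (∀ u v → col G u v ≡ bi → col H (f u) (f v) ≡ bi)
    × (∀ v vs → IsClosedWalk G v vs → AllUnicoloured G v vs →
         AllUnicoloured H (f v) (map f vs) →
         redCount G (steps v vs) % 2 ≡ redCount H (steps (f v) (map f vs)) % 2)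

-- Let K be the blue component of H containing the closed blue walk f(C), and call a vertex
-- d above K if it exceeds every vertex of K lying in its part. The engine is a two-step
-- bound: if p–q is an edge, z < p and u < q, and z–u–w is a blue path with p–u not blue,
-- then w < p (else the min ordering creates an edge p–u, which is bicoloured and so puts p
-- before z). Starting from a blue edge below p–q, this bound spreads over all of K as long
-- as p and q have no blue edge into K. For a bicoloured edge of f'(C) specialness keeps p, q
-- away from K, so its endpoints are above K; along a blue edge of f'(C) starting above K,
-- the endpoints are unreachable from K, so being above K propagates. As C is closed, every
-- f'(y) is above K while every f(x) lies in K, hence f(x) ≠ f'(y).
module Submission where

open import Defs
open import Data.Nat using (ℕ)
open import Data.Fin using (Fin)
open import Data.Bool using (Bool; true; false; not)
open import Data.Bool.Properties using (¬-not)
open import Data.List using (List; []; _∷_)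
open import Data.List.Relation.Unary.All using (All; []; _∷_)
open import Data.List.Relation.Unary.Any using (Any; here; there)
open import Data.List.Membership.Propositional using (_∈_)
open import Data.Product using (_×_; _,_; proj₁; proj₂; swap)
open import Data.Sum using (_⊎_; inj₁; inj₂)
open import Data.Empty using (⊥-elim)
open import Data.Unit using (tt)
open import Function using (_∘_)
open import Relation.Nullary using (¬_)
open import Relation.Binary using (IsStrictTotalOrder; tri<; tri≈; tri>)
open import Relation.Binary.Construct.Closure.ReflexiveTransitive using (Star; ε; _◅_; _◅◅_; reverse)
open import Relation.Binary.PropositionalEquality using (_≡_; _≢_; refl; sym; trans; cong; subst)

lastV∈ : {A : Set} (v : A) (vs : List A) → lastV v vs ∈ v ∷ vs
lastV∈ v []       = here refl
lastV∈ v (w ∷ ws) = there (lastV∈ w ws)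

module SpecialMinOrdering {n : ℕ} (H : SignedGraph n) (part : Fin n → Bool)
  (_<_ : Fin n → Fin n → Set) (no-red : NoPurelyRed H) (bipartite : BipartiteWith H part)
  (strict-total : IsStrictTotalOrder _≡_ _<_) (min-ordering : IsMinOrdering H part _<_)
  (special : IsSpecial H _<_) where

  open IsStrictTotalOrder strict-total using (compare; irrefl; asym)
  open import Relation.Binary.Construct.StrictToNonStrict _≡_ _<_ using (_≤_)

  Edge Blue : Fin n → Fin n → Set
  Edge x y = IsEdge (col H x y)
  Blue x y = col H x y ≡ blue

  edge-sym : ∀ {x y} → Edge x y → Edge y x
  edge-sym {x} {y} e eq = e (trans (col-sym H x y) eq)

  colour-sym : ∀ {x y c} → col H x y ≡ c → col H y x ≡ c
  colour-sym {x} {y} eq = trans (col-sym H y x) eq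

  blue⇒edge : ∀ {x y} → Blue x y → Edge x y
  blue⇒edge xy xy-none with () ← trans (sym xy) xy-none

  bi⇒edge : ∀ {x y} → col H x y ≡ bi → Edge x y
  bi⇒edge xy xy-none with () ← trans (sym xy) xy-none

  edge⇒blue⊎bi : ∀ {x y} → Edge x y → Blue x y ⊎ col H x y ≡ bi
  edge⇒blue⊎bi {x} {y} e with col H x y in eq
  ... | none = ⊥-elim (e refl)
  ... | blue = inj₁ refl
  ... | red  = ⊥-elim (no-red x y eq)
  ... | bi   = inj₂ refl

  neighbours-same-side : ∀ {x x' y y'} → part x ≡ part x' → Edge x y → Edge x' y' →
                         part y ≡ part y'
  neighbours-same-side {x} {x'} {y} {y'} x∼x' xy x'y' =
    trans (¬-not (bipartite y x (edge-sym xy)))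
          (trans (cong not x∼x') (sym (¬-not (bipartite y' x' (edge-sym x'y')))))

  min-ordering-sym : ∀ {x y x' y'} → part x ≡ part x' → part y ≡ part y' →
                     Edge x y → Edge x' y' → x < x' → y' < y → Edge x y'
  min-ordering-sym {x} {y} {x'} {y'} x∼x' y∼y' xy x'y' x<x' y'<y = by-side (part x) refl
    where
      by-side : ∀ s → part x ≡ s → Edge x y'
      by-side true x∈A =
        min-ordering x y x' y' x∈A (trans (sym x∼x') x∈A) y∈B (trans (sym y∼y') y∈B)
                     xy x'y' x<x' y'<y
        where y∈B = trans (¬-not (bipartite y x (edge-sym xy))) (cong not x∈A)
      by-side false x∈B =
        edge-sym (min-ordering y' x' y x (trans (sym y∼y') y∈A) y∈A (trans (sym x∼x') x∈B) x∈B
                               (edge-sym x'y') (edge-sym xy) y'<y x<x')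
        where y∈A = trans (¬-not (bipartite y x (edge-sym xy))) (cong not x∈B)

  bi-precedes-blue : ∀ {v u w} → col H v u ≡ bi → Blue v w → u < w
  bi-precedes-blue {v} {u} {w} vu vw = special v u w vu (subst Unicoloured (sym vw) tt)

  ≤⇒≯ : ∀ {x y} → x ≤ y → ¬ y < x
  ≤⇒≯ (inj₁ x<y)  y<x = asym x<y y<x
  ≤⇒≯ (inj₂ refl) x<x = irrefl refl x<x

  ≤∧≢⇒< : ∀ {x y} → x ≤ y → x ≢ y → x < y
  ≤∧≢⇒< (inj₁ x<y) _   = x<y
  ≤∧≢⇒< (inj₂ x≡y) x≢y = ⊥-elim (x≢y x≡y)

  below-two-step : ∀ {p q z u w} → Edge p q → ¬ Blue p u → Blue z u → Blue u w →
                   (part z ≡ part p → z < p) → (part u ≡ part q → u < q) →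
                   part w ≡ part p → w < p
  below-two-step {p} {q} {z} {u} {w} pq ¬pu zu uw z<p u<q w∼p with compare w p
  ... | tri< w<p _ _ = w<p
  ... | tri≈ _ refl _ = ⊥-elim (¬pu (colour-sym uw))
  ... | tri> _ _ p<w
      with edge⇒blue⊎bi (min-ordering-sym (sym w∼p) q∼u pq (edge-sym (blue⇒edge uw))
                                          p<w (u<q (sym q∼u)))
    where q∼u = neighbours-same-side (sym w∼p) pq (edge-sym (blue⇒edge uw))
  ...   | inj₁ pu = ⊥-elim (¬pu pu)
  ...   | inj₂ pu = ⊥-elim (asym (z<p z∼p) (bi-precedes-blue (colour-sym pu) (colour-sym zu)))
    where z∼p = trans (neighbours-same-side refl (edge-sym (blue⇒edge zu)) (blue⇒edge uw)) w∼p

  Below : Fin n → Fin n → Fin n → Set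
  Below p q g = (part g ≡ part p → g < p) × (part g ≡ part q → g < q)

  below-on-side : ∀ {p q a} → Edge p q → part a ≡ part p → a < p → Below p q a
  below-on-side {p} {q} pq a∼p a<p =
    (λ _ → a<p) , (λ a∼q → ⊥-elim (bipartite p q pq (trans (sym a∼p) a∼q)))

  below-closed : ∀ {p q z u w} → Edge p q → ¬ Blue p u → ¬ Blue q u → Blue z u → Blue u w →
                 Below p q z → Below p q u → Below p q w
  below-closed pq ¬pu ¬qu zu uw (z<p , z<q) (u<p , u<q) =
    below-two-step pq ¬pu zu uw z<p u<q , below-two-step (edge-sym pq) ¬qu zu uw z<q u<p

  bi-not-blue-below : ∀ {p q u} → col H p q ≡ bi → (part u ≡ part q → u < q) → ¬ Blue p u
  bi-not-blue-below pq u<q pu =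
    asym (u<q (neighbours-same-side refl (blue⇒edge pu) (bi⇒edge pq))) (bi-precedes-blue pq pu)

  module BlueComponent (r : Fin n) where

    Reach : Fin n → Set
    Reach = Star Blue r

    Above : Fin n → Set
    Above d = ∀ {g} → Reach g → part g ≡ part d → g < d

    above⇒unreachable : ∀ {d} → Above d → ¬ Reach d
    above⇒unreachable above rd = irrefl refl (above rd refl)

    Fenced : Fin n → Fin n → Set
    Fenced p q = ∀ {u} → Reach u → Below p q u → ¬ Blue p u × ¬ Blue q u

    below-along : ∀ {p q z u g} → Edge p q → Fenced p q → Reach u → Blue z u →
                  Below p q z → Below p q u → Star Blue u g → Below p q g
    below-along pq fenced ru zu bz bu ε = bu
    below-along pq fenced ru zu bz bu (uw ◅ wg) =
      below-along pq fenced (ru ◅◅ uw ◅ ε) uw bu (below-closed pq ¬pu ¬qu zu uw bz bu) wg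
      where
        ¬pu = proj₁ (fenced ru bu)
        ¬qu = proj₂ (fenced ru bu)

    below-component : ∀ {p q a b} → Edge p q → Fenced p q → Blue a b → Reach a →
                      Below p q a → Below p q b → ∀ {g} → Reach g → Below p q g
    below-component pq fenced ab ra ba bb rg =
      below-along pq fenced ra (colour-sym ab) bb ba (reverse colour-sym ra ◅◅ rg)

    above-bi : ∀ {p q a b} → col H p q ≡ bi → Blue a b → Reach a → a ≤ p → b ≤ q →
               part a ≡ part p → part b ≡ part q → Above q
    above-bi {p} {q} {a} {b} pq ab ra a≤p b≤q a∼p b∼q rg =
      proj₂ (below-component (bi⇒edge pq) fenced ab ra (below-on-side (bi⇒edge pq) a∼p a<p)
                             (swap (below-on-side (bi⇒edge (colour-sym pq)) b∼q b<q)) rg)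
      where
        a<p : a < p
        a<p = ≤∧≢⇒< a≤p λ { refl → ≤⇒≯ b≤q (bi-precedes-blue pq ab) }
        b<q : b < q
        b<q = ≤∧≢⇒< b≤q λ { refl → ≤⇒≯ a≤p (bi-precedes-blue (colour-sym pq) (colour-sym ab)) }
        fenced : Fenced p q
        fenced _ (u<p , u<q) = bi-not-blue-below pq u<q , bi-not-blue-below (colour-sym pq) u<p

    above-blue : ∀ {p q a b} → Blue p q → Above p → Blue a b → Reach a → b ≤ q →
                 part a ≡ part p → part b ≡ part q → Above q
    above-blue {p} {q} {a} {b} pq above-p ab ra b≤q a∼p b∼q rg =
      proj₂ (below-component (blue⇒edge pq) fenced ab ra
                             (below-on-side (blue⇒edge pq) a∼p (above-p ra a∼p))
                             (swap (below-on-side (blue⇒edge (colour-sym pq)) b∼q b<q)) rg)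
      where
        ¬rp : ¬ Reach p
        ¬rp = above⇒unreachable above-p
        ¬rq : ¬ Reach q
        ¬rq rq = ¬rp (rq ◅◅ colour-sym pq ◅ ε)
        b<q : b < q
        b<q = ≤∧≢⇒< b≤q λ { refl → ¬rq (ra ◅◅ ab ◅ ε) }
        fenced : Fenced p q
        fenced ru _ = (λ pu → ¬rp (ru ◅◅ colour-sym pu ◅ ε)) , (λ qu → ¬rq (ru ◅◅ colour-sym qu ◅ ε))

module ClosedWalkImages {m n : ℕ} (H : SignedGraph n) (part : Fin n → Bool)
  (_<_ : Fin n → Fin n → Set) (no-red : NoPurelyRed H) (bipartite : BipartiteWith H part)
  (strict-total : IsStrictTotalOrder _≡_ _<_) (min-ordering : IsMinOrdering H part _<_)
  (special : IsSpecial H _<_) (G : SignedGraph m) (f f' : Fin m → Fin n)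
  (f'-edge : ∀ u w → IsEdge (col G u w) → IsEdge (col H (f' u) (f' w)))
  (same-part : ∀ x → part (f x) ≡ part (f' x)) (f≤f' : ∀ x → (f x < f' x) ⊎ (f x ≡ f' x))
  (r : Fin n) where

  open SpecialMinOrdering H part _<_ no-red bipartite strict-total min-ordering special
  open BlueComponent r public

  BlueUnder-f : Fin m × Fin m → Set
  BlueUnder-f e = Blue (f (proj₁ e)) (f (proj₂ e))

  BiUnder-f' : Fin m × Fin m → Set
  BiUnder-f' e = col H (f' (proj₁ e)) (f' (proj₂ e)) ≡ bi

  above-after-bi : ∀ {u w} → Blue (f u) (f w) → Reach (f u) → BiUnder-f' (u , w) → Above (f' w)
  above-after-bi {u} {w} b ru bc = above-bi bc b ru (f≤f' u) (f≤f' w) (same-part u) (same-part w)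

  above-step : ∀ {u w} → IsEdge (col G u w) → Blue (f u) (f w) → Reach (f u) →
               Above (f' u) → Above (f' w)
  above-step {u} {w} e b ru au with edge⇒blue⊎bi (f'-edge u w e)
  ... | inj₁ bl = above-blue bl au b ru (f≤f' w) (same-part u) (same-part w)
  ... | inj₂ bc = above-after-bi b ru bc

  reach-along : ∀ u ws → All BlueUnder-f (steps u ws) → Reach (f u) →
                ∀ x → x ∈ u ∷ ws → Reach (f x)
  reach-along u ws _ ru x (here refl) = ru
  reach-along u (w ∷ ws) (b ∷ bs) ru x (there x∈) = reach-along w ws bs (ru ◅◅ b ◅ ε) x x∈

  above-along : ∀ u ws → IsWalk G u ws → All BlueUnder-f (steps u ws) → Reach (f u) →
                Above (f' u) → ∀ y → y ∈ u ∷ ws → Above (f' y)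
  above-along u ws _ _ _ au y (here refl) = au
  above-along u (w ∷ ws) (e ∷ es) (b ∷ bs) ru au y (there y∈) =
    above-along w ws es bs (ru ◅◅ b ◅ ε) (above-step e b ru au) y y∈

  above-last : ∀ u ws → IsWalk G u ws → All BlueUnder-f (steps u ws) → Reach (f u) →
               Any BiUnder-f' (steps u ws) → Above (f' (lastV u ws))
  above-last u (w ∷ ws) (e ∷ es) (b ∷ bs) ru (here bc) =
    above-along w ws es bs (ru ◅◅ b ◅ ε) (above-after-bi b ru bc) (lastV w ws) (lastV∈ w ws)
  above-last u (w ∷ ws) (e ∷ es) (b ∷ bs) ru (there bc) = above-last w ws es bs (ru ◅◅ b ◅ ε) bc

theorem4 : {m n : ℕ} (H : SignedGraph n) (part : Fin n → Bool) (_<_ : Fin n → Fin n → Set) →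
    WeaklyBalanced H → NoPurelyRed H → BipartiteWith H part →
    IsStrictTotalOrder _≡_ _<_ → IsMinOrdering H part _<_ → IsSpecial H _<_ →
    (G : SignedGraph m) (v : Fin m) (vs : List (Fin m)) → IsClosedWalk G v vs →
    (f f' : Fin m → Fin n) → IsHom G H f → IsHom G H f' →
    (∀ x → part (f x) ≡ part (f' x)) →
    (∀ x → (f x < f' x) ⊎ (f x ≡ f' x)) →
    All (λ p → col H (f (proj₁ p)) (f (proj₂ p)) ≡ blue) (steps v vs) →
    Any (λ p → col H (f' (proj₁ p)) (f' (proj₂ p)) ≡ bi) (steps v vs) →
    ∀ x y → x ∈ (v ∷ vs) → y ∈ (v ∷ vs) → f x ≢ f' y
theorem4 H part _<_ _ no-red bipartite strict-total min-ordering special G v vs (walk , closed)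
         f f' _ (f'-edge , _) same-part f≤f' blue-image bi-image x y x∈ y∈ fx≡f'y =
  IsStrictTotalOrder.irrefl strict-total fx≡f'y (above-f'y (reach-f x x∈) (cong part fx≡f'y))
  where
    open ClosedWalkImages H part _<_ no-red bipartite strict-total min-ordering special
                          G f f' f'-edge same-part f≤f' (f v)
    reach-f : ∀ x → x ∈ v ∷ vs → Reach (f x)
    reach-f = reach-along v vs blue-image ε
    above-f'v : Above (f' v)
    above-f'v = subst (Above ∘ f') closed (above-last v vs walk blue-image ε bi-image)
    above-f'y : Above (f' y)
    above-f'y = above-along v vs walk blue-image ε above-f'v y y∈
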